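{- Let $k$ be a positive integer and $\mathbb{F}$ a field of characteristic different from $2$ in which $k \neq -1$. Then for any $k-1$ homogeneous linear forms $\ell_1,\dots,\ell_{k-1}$ over $\mathbb{F}$ in the variables $X_1,\dots,X_{k+1}$, the polynomial $S^2_{2k}(X_1,\dots,X_{k+1},\ell_1,\dots,\ell_{k-1})$ is not zero.
   Context: $S_n^2(X_1,\dots,X_n) = \sum_{1\le i<j\le n} X_iX_j$; a homogeneous linear form is $\sum_k a_kX_k$ with coefficients in $\mathbb{F}$. -}

module Defs where

open import Level using (Level; _⊔_)
open import Data.Nat using (ℕ; zero; suc; _<ᵇ_)
import Data.Nat as N
open import Data.Bool using (if_then_else_)
open import Data.Fin using (Fin; toℕ; _≟_; _<_; _≤_)
open import Data.Fin using () renaming (zero to fz; suc to fs)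
open import Data.Product using (Σ) renaming (_×_ to _∧_)
open import Relation.Nullary using (¬_; yes; no)
open import Algebra.Bundles using (CommutativeRing)
import Algebra.Definitions.RawMonoid as RM

IsField : ∀ {c ℓ} → CommutativeRing c ℓ → Set (c ⊔ ℓ)
IsField F = ¬ (1# ≈ 0#) ∧ (∀ x → ¬ (x ≈ 0#) → Σ Carrier λ y → x * y ≈ 1#)
  where open CommutativeRing F

module _ {c ℓ} (F : CommutativeRing c ℓ) where
  open CommutativeRing F
  open RM +-rawMonoid using () renaming (_×_ to _·_)

  -- n · 1 in F (so characteristic ≠ 2 is ¬ (2 · 1 ≈ 0), and
  -- "k ≠ -1 in F" is ¬ ((k+1) · 1 ≈ 0)).
  natF : ℕ → Carrier
  natF n = n · 1#

  LinForm : ℕ → Set c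
  LinForm n = Fin n → Carrier

  var : ∀ {n} → Fin n → LinForm n
  var i j with i ≟ j
  ... | yes _ = 1#
  ... | no  _ = 0#

  -- a homogeneous quadratic polynomial in n variables, given by the
  -- coefficient of the monomial X_i X_j (only queried for i ≤ j)
  QuadForm : ℕ → Set c
  QuadForm n = Fin n → Fin n → Carrier

  mulLin : ∀ {n} → LinForm n → LinForm n → QuadForm n
  mulLin a b i j with i ≟ j
  ... | yes _ = a i * b i
  ... | no  _ = a i * b j + a j * b i

  sumFin : ∀ {m} → (Fin m → Carrier) → Carrier
  sumFin {zero}  f = 0#
  sumFin {suc m} f = f fz + sumFin (λ a → f (fs a))

  S2 : ∀ {m n} → (Fin m → LinForm n) → QuadForm n
  S2 Y i j = sumFin λ a → sumFin λ b →
    if toℕ a <ᵇ toℕ b then mulLin (Y a) (Y b) i j else 0#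

  IsZeroQuad : ∀ {n} → QuadForm n → Set ℓ
  IsZeroQuad {n} q = ∀ (i j : Fin n) → i ≤ j → q i j ≈ 0#

  -- the list of linear forms X_1,…,X_{k+1}, ℓ_1,…,ℓ_{k-1}
  -- (length (k+1) + (k-1) = 2k; here written for k = suc k')
  appendForms : ∀ {p q n} → (Fin p → LinForm n) → (Fin q → LinForm n)
              → Fin (p N.+ q) → LinForm n
  appendForms {zero}  f g a      = g a
  appendForms {suc p} f g fz     = f fz
  appendForms {suc p} f g (fs a) = appendForms (λ x → f (fs x)) g a

-- If S²(Y₁,…,Y_m) vanishes then (∑ Yₐ)² = ∑ Yₐ² coefficientwise. For
-- Y = (X₁,…,X_{k+1},ℓ₁,…,ℓ_{k-1}) and L = ∑ Yₐ this reads
-- X₁² + ⋯ + X²_{k+1} = L² − ℓ₁² − ⋯ − ℓ²_{k-1}, i.e. the identity matrix of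
-- size k+1 is a sum of k rank-one matrices. Gaussian elimination removes one
-- rank-one term and one coordinate at a time, down to 1 = 0.
module Submission where

open import Defs
open import Level using (_⊔_)
open import Data.Nat using (ℕ; suc)
open import Data.Fin using (Fin)
open import Relation.Nullary using (¬_)
open import Algebra.Bundles using (CommutativeRing)

open import Data.Nat as ℕ using (zero; _<ᵇ_)
open import Data.Nat.Properties using (<⇒≤)
open import Data.Fin using (toℕ; punchIn; _≟_) renaming (zero to fz; suc to fs)
open import Data.Fin.Properties using (punchIn-injective; punchInᵢ≢i; <-cmp; ≤-refl)
open import Data.Bool using (Bool; true; false; if_then_else_)
open import Data.Product using (∃; _,_; proj₁; proj₂)
open import Function using (_∘_; flip; Injective)
open import Relation.Nullary using (Dec; yes; no; contradiction)
open import Relation.Binary using (tri<; tri≈; tri>)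
open import Relation.Binary.PropositionalEquality as ≡ using (_≡_; _≢_)

module _ {c ℓ} (F : CommutativeRing c ℓ) where
  open CommutativeRing F
  open import Algebra.Properties.Ring ring
    using (-1*x≈-x; -‿distribˡ-*; -‿distribʳ-*; -‿involutive; +-inverseʳ-unique)
  open import Algebra.Properties.Semiring.Sum semiring
    using (sum; sum-syntax; sum-cong-≋; sum-cong-≗; sum-replicate-zero; sum-remove;
           ∑-distrib-+; *-distribˡ-sum; *-distribʳ-sum)
  open import Relation.Binary.Reasoning.Setoid setoid
  open import Algebra.Properties.CommutativeSemigroup *-commutativeSemigroup using (x∙yz≈y∙xz; xy∙z≈x∙zy)
  open import Algebra.Solver.CommutativeMonoid +-commutativeMonoid using (solve; _⊕_; _⊜_)

  ≡⇒≈ : ∀ {x y} → x ≡ y → x ≈ y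
  ≡⇒≈ ≡.refl = refl

  sumFin≡sum : ∀ {m} (f : Fin m → Carrier) → sumFin F f ≡ sum f
  sumFin≡sum {zero}  f = ≡.refl
  sumFin≡sum {suc m} f = ≡.cong (f fz +_) (sumFin≡sum (f ∘ fs))

  sum-zero : ∀ {m} {f : Fin m → Carrier} → (∀ a → f a ≈ 0#) → sum f ≈ 0#
  sum-zero {m} f≈0 = trans (sum-cong-≋ f≈0) (sum-replicate-zero m)

  sum-neg : ∀ {m} (f : Fin m → Carrier) → ∑[ a < m ] (- f a) ≈ - sum f
  sum-neg {m} f = begin
    ∑[ a < m ] (- f a)        ≈⟨ sum-cong-≋ (λ a → sym (-1*x≈-x (f a))) ⟩
    ∑[ a < m ] (- 1# * f a)   ≈⟨ *-distribˡ-sum (- 1#) f ⟨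
    - 1# * sum f              ≈⟨ -1*x≈-x (sum f) ⟩
    - sum f                   ∎

  sum*sum≈∑∑ : ∀ {m n} (x : Fin m → Carrier) (y : Fin n → Carrier) →
    sum x * sum y ≈ ∑[ a < m ] ∑[ b < n ] (x a * y b)
  sum*sum≈∑∑ x y = trans (*-distribʳ-sum (sum y) x)
                         (sum-cong-≋ (λ a → *-distribˡ-sum (x a) y))

  var-diag : ∀ {n} (i : Fin n) → var F i i ≡ 1#
  var-diag i with i ≟ i
  ... | yes _   = ≡.refl
  ... | no i≢i = contradiction ≡.refl i≢i

  var-offdiag : ∀ {n} {i j : Fin n} → i ≢ j → var F i j ≡ 0#
  var-offdiag {i = i} {j} i≢j with i ≟ j
  ... | yes i≡j = contradiction i≡j i≢j
  ... | no _    = ≡.refl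

  var-injective : ∀ {m n} {f : Fin m → Fin n} → Injective _≡_ _≡_ f →
    ∀ i j → var F (f i) (f j) ≡ var F i j
  var-injective {f = f} f-inj i j = by-cases (i ≟ j)
    where
      by-cases : Dec (i ≡ j) → var F (f i) (f j) ≡ var F i j
      by-cases (yes ≡.refl) = ≡.trans (var-diag (f i)) (≡.sym (var-diag i))
      by-cases (no i≢j)     = ≡.trans (var-offdiag (i≢j ∘ f-inj)) (≡.sym (var-offdiag i≢j))

  ∑-var : ∀ {n} (i : Fin n) (f : Fin n → Carrier) → ∑[ a < n ] (var F a i * f a) ≈ f i
  ∑-var {suc n} i f = begin
    ∑[ a < suc n ] (var F a i * f a)
      ≈⟨ sum-remove {n} {i} (λ a → var F a i * f a) ⟩
    var F i i * f i + ∑[ r < n ] (var F (punchIn i r) i * f (punchIn i r))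
      ≈⟨ +-cong (*-cong (≡⇒≈ (var-diag i)) refl) (sum-zero offdiag≈0) ⟩
    1# * f i + 0#
      ≈⟨ trans (+-identityʳ _) (*-identityˡ (f i)) ⟩
    f i ∎
    where
      offdiag≈0 : ∀ r → var F (punchIn i r) i * f (punchIn i r) ≈ 0#
      offdiag≈0 r = trans (*-cong (≡⇒≈ (var-offdiag (punchInᵢ≢i i r))) refl) (zeroˡ _)

  mulLin-diag : ∀ {n} (x y : LinForm F n) i → mulLin F x y i i ≈ x i * y i
  mulLin-diag x y i with i ≟ i
  ... | yes _   = refl
  ... | no i≢i = contradiction ≡.refl i≢i

  mulLin-offdiag : ∀ {n} (x y : LinForm F n) {i j} → i ≢ j →
    mulLin F x y i j ≈ x i * y j + x j * y i
  mulLin-offdiag x y {i} {j} i≢j with i ≟ j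
  ... | yes i≡j = contradiction i≡j i≢j
  ... | no _    = refl

  sum-appendForms : ∀ {n} p {q} (f : Fin p → LinForm F n) (g : Fin q → LinForm F n)
    (h : LinForm F n → Carrier) →
    ∑[ a < p ℕ.+ q ] h (appendForms F f g a) ≈ ∑[ a < p ] h (f a) + ∑[ b < q ] h (g b)
  sum-appendForms zero    f g h = sym (+-identityˡ _)
  sum-appendForms (suc p) f g h =
    trans (+-congˡ (sum-appendForms p (f ∘ fs) g h)) (sym (+-assoc _ _ _))

  when : Bool → Carrier → Carrier
  when b x = if b then x else 0#

  upperSum : ∀ {m} → (Fin m → Fin m → Carrier) → Carrier
  upperSum {m} g = ∑[ a < m ] ∑[ b < m ] when (toℕ a <ᵇ toℕ b) (g a b)

  upperSum-cong : ∀ {m} {g h : Fin m → Fin m → Carrier} →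
    (∀ a b → g a b ≈ h a b) → upperSum g ≈ upperSum h
  upperSum-cong g≈h = sum-cong-≋ (λ a → sum-cong-≋ (λ b → when-cong _ (g≈h a b)))
    where
      when-cong : ∀ b {x y} → x ≈ y → when b x ≈ when b y
      when-cong true  x≈y = x≈y
      when-cong false _   = refl

  upperSum-+ : ∀ {m} (g h : Fin m → Fin m → Carrier) →
    upperSum (λ a b → g a b + h a b) ≈ upperSum g + upperSum h
  upperSum-+ {m} g h =
    trans (sum-cong-≋ {m} (λ a → trans (sum-cong-≋ {m} (λ b → when-+ _ (g a b) (h a b)))
                                       (∑-distrib-+ {m} _ _)))
          (∑-distrib-+ {m} _ _)
    where
      when-+ : ∀ b x y → when b (x + y) ≈ when b x + when b y
      when-+ true  x y = refl
      when-+ false x y = sym (+-identityˡ 0#)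

  upperSum-suc : ∀ {m} (g : Fin (suc m) → Fin (suc m) → Carrier) →
    upperSum g ≈ ∑[ b < m ] g fz (fs b) + upperSum (λ a b → g (fs a) (fs b))
  upperSum-suc {m} g = +-cong (+-identityˡ _) (sum-cong-≋ {m} (λ _ → +-identityˡ _))

  ∑∑≈upper+lower+diagonal : ∀ {m} (g : Fin m → Fin m → Carrier) →
    ∑[ a < m ] ∑[ b < m ] g a b ≈ upperSum g + upperSum (flip g) + ∑[ a < m ] g a a
  ∑∑≈upper+lower+diagonal {zero}  g = sym (trans (+-identityʳ _) (+-identityʳ 0#))
  ∑∑≈upper+lower+diagonal {suc m} g = begin
    (g₀₀ + row) + ∑[ a < m ] (g (fs a) fz + ∑[ b < m ] g′ a b)
      ≈⟨ +-congˡ (∑-distrib-+ {m} _ _) ⟩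
    (g₀₀ + row) + (col + ∑[ a < m ] ∑[ b < m ] g′ a b)
      ≈⟨ +-congˡ (+-congˡ (∑∑≈upper+lower+diagonal g′)) ⟩
    (g₀₀ + row) + (col + (upperSum g′ + upperSum (flip g′) + diag′))
      ≈⟨ solve 6 (λ g₀₀ r c u l d → (g₀₀ ⊕ r) ⊕ (c ⊕ ((u ⊕ l) ⊕ d)) ⊜ ((r ⊕ u) ⊕ (c ⊕ l)) ⊕ (g₀₀ ⊕ d))
           refl g₀₀ row col (upperSum g′) (upperSum (flip g′)) diag′ ⟩
    (row + upperSum g′) + (col + upperSum (flip g′)) + (g₀₀ + diag′)
      ≈⟨ +-cong (+-cong (upperSum-suc g) (upperSum-suc (flip g))) refl ⟨
    upperSum g + upperSum (flip g) + ∑[ a < suc m ] g a a ∎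
    where
      g₀₀ = g fz fz
      g′ = λ a b → g (fs a) (fs b)
      row = ∑[ b < m ] g fz (fs b)
      col = ∑[ a < m ] g (fs a) fz
      diag′ = ∑[ a < m ] g′ a a

  module _ {m n} (Y : Fin m → LinForm F n) where

    S2≡upperSum : ∀ i j → S2 F Y i j ≡ upperSum (λ a b → mulLin F (Y a) (Y b) i j)
    S2≡upperSum i j = ≡.trans (sumFin≡sum {m} _) (sum-cong-≗ {m} (λ a → sumFin≡sum {m} _))

    square-of-sum≈sum-of-squares-at : ∀ i j → S2 F Y i j ≈ 0# →
      (∑[ a < m ] Y a i) * (∑[ a < m ] Y a j) ≈ ∑[ a < m ] (Y a i * Y a j)
    square-of-sum≈sum-of-squares-at i j S2ᵢⱼ≈0 = begin
      (∑[ a < m ] Y a i) * (∑[ a < m ] Y a j)  ≈⟨ sum*sum≈∑∑ (λ a → Y a i) (λ b → Y b j) ⟩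
      ∑[ a < m ] ∑[ b < m ] g a b              ≈⟨ ∑∑≈upper+lower+diagonal g ⟩
      upper + lower + ∑[ a < m ] g a a         ≈⟨ +-congʳ (upper+lower≈0 (i ≟ j)) ⟩
      0# + ∑[ a < m ] g a a                    ≈⟨ +-identityˡ _ ⟩
      ∑[ a < m ] (Y a i * Y a j)               ∎
      where
        g = λ a b → Y a i * Y b j
        upper = upperSum g
        lower = upperSum (flip g)
        S2ᵢⱼ≈0′ : upperSum (λ a b → mulLin F (Y a) (Y b) i j) ≈ 0#
        S2ᵢⱼ≈0′ = trans (≡⇒≈ (≡.sym (S2≡upperSum i j))) S2ᵢⱼ≈0

        upper+lower≈0 : Dec (i ≡ j) → upper + lower ≈ 0#
        upper+lower≈0 (yes ≡.refl) = trans (+-cong upper≈0 lower≈0) (+-identityˡ 0#)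
          where
            upper≈0 : upper ≈ 0#
            upper≈0 = trans (upperSum-cong {m} λ a b → sym (mulLin-diag (Y a) (Y b) i)) S2ᵢⱼ≈0′
            lower≈0 : lower ≈ 0#
            lower≈0 = trans (upperSum-cong {m} λ a b → *-comm _ _) upper≈0
        upper+lower≈0 (no i≢j) = begin
          upper + lower                                       ≈⟨ upperSum-+ g (flip g) ⟨
          upperSum (λ a b → g a b + g b a)                    ≈⟨ upperSum-cong {m} (λ a b → +-congˡ (*-comm _ _)) ⟩
          upperSum (λ a b → Y a i * Y b j + Y a j * Y b i)    ≈⟨ upperSum-cong {m} (λ a b → mulLin-offdiag (Y a) (Y b) i≢j) ⟨
          upperSum (λ a b → mulLin F (Y a) (Y b) i j)         ≈⟨ S2ᵢⱼ≈0′ ⟩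
          0#                                                  ∎

    square-of-sum≈sum-of-squares : IsZeroQuad F (S2 F Y) →
      ∀ i j → (∑[ a < m ] Y a i) * (∑[ a < m ] Y a j) ≈ ∑[ a < m ] (Y a i * Y a j)
    square-of-sum≈sum-of-squares S2≈0 i j with <-cmp i j
    ... | tri< i<j _ _  = square-of-sum≈sum-of-squares-at i j (S2≈0 i j (<⇒≤ i<j))
    ... | tri≈ _ ≡.refl _ = square-of-sum≈sum-of-squares-at i i (S2≈0 i i ≤-refl)
    ... | tri> _ _ j<i  = trans (*-comm _ _)
      (trans (square-of-sum≈sum-of-squares-at j i (S2≈0 j i (<⇒≤ j<i)))
             (sum-cong-≋ {m} λ a → *-comm _ _))

  -- The n × n identity matrix as a sum of m rank-one matrices (left r)ᵀ (right r).
  record IdentityFactorisation (m n : ℕ) : Set (c ⊔ ℓ) where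
    field
      left right : Fin m → Fin n → Carrier
      factorises : ∀ i j → ∑[ r < m ] (left r i * right r j) ≈ var F i j

  ∑≉0⇒¬¬∃≉0 : ∀ {m} (f : Fin m → Carrier) → ¬ sum f ≈ 0# → ¬ ¬ (∃ λ r → ¬ f r ≈ 0#)
  ∑≉0⇒¬¬∃≉0 {zero}  f ∑f≉0 _ = ∑f≉0 refl
  ∑≉0⇒¬¬∃≉0 {suc m} f ∑f≉0 ∄ = ∑≉0⇒¬¬∃≉0 (f ∘ fs) tail≉0 λ (r , fr≉0) → ∄ (fs r , fr≉0)
    where
      tail≉0 : ¬ sum (f ∘ fs) ≈ 0#
      tail≉0 tail≈0 = ∄ (fz , λ head≈0 → ∑f≉0 (trans (+-cong head≈0 tail≈0) (+-identityˡ 0#)))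

  -x*-y≈x*y : ∀ x y → - x * - y ≈ x * y
  -x*-y≈x*y x y = begin
    - x * - y     ≈⟨ -‿distribˡ-* x (- y) ⟨
    - (x * - y)   ≈⟨ -‿cong (-‿distribʳ-* x y) ⟨
    - - (x * y)   ≈⟨ -‿involutive (x * y) ⟩
    x * y         ∎

  cancel-pivot-column : ∀ {a b c t x y z} → t * c ≈ b → a * b + x ≈ z → a * c + y ≈ 0# →
    x + - t * y ≈ z
  cancel-pivot-column {a} {b} {c} {t} {x} {y} {z} tc≈b ab+x≈z ac+y≈0 = begin
    x + - t * y          ≈⟨ +-congˡ (*-congˡ (+-inverseʳ-unique (a * c) y ac+y≈0)) ⟩
    x + - t * - (a * c)  ≈⟨ +-congˡ (-x*-y≈x*y t (a * c)) ⟩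
    x + t * (a * c)      ≈⟨ +-congˡ (x∙yz≈y∙xz t a c) ⟩
    x + a * (t * c)      ≈⟨ +-congˡ (*-congˡ tc≈b) ⟩
    x + a * b            ≈⟨ +-comm x (a * b) ⟩
    a * b + x            ≈⟨ ab+x≈z ⟩
    z                    ∎

  module _ (isField : IsField F) where
    open IdentityFactorisation

    1≉0 : ¬ 1# ≈ 0#
    1≉0 = proj₁ isField

    no-factorisation-through-zero : ∀ {n} → ¬ IdentityFactorisation 0 (suc n)
    no-factorisation-through-zero φ = 1≉0 (sym (factorises φ fz fz))

    pivot-exists : ∀ {m n} (φ : IdentityFactorisation m n) (q : Fin n) →
      ¬ ¬ (∃ λ p → ¬ right φ p q ≈ 0#)
    pivot-exists {m} φ q ∄ = ∑≉0⇒¬¬∃≉0 _ ∑≉0 λ (p , term≉0) →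
        ∄ (p , λ right≈0 → term≉0 (trans (*-congˡ right≈0) (zeroʳ _)))
      where
        ∑≉0 : ¬ ∑[ r < m ] (left φ r q * right φ r q) ≈ 0#
        ∑≉0 ∑≈0 = 1≉0 (trans (trans (≡⇒≈ (≡.sym (var-diag q))) (sym (factorises φ q q))) ∑≈0)

    -- Gaussian elimination with pivot (p, q): subtracting multiples of
    -- column q clears row p of `right`, leaving a factorisation of the
    -- identity on the coordinates other than q by the terms other than p.
    eliminate : ∀ {m n} (φ : IdentityFactorisation (suc m) (suc n))
      (p : Fin (suc m)) (q : Fin (suc n)) → ¬ right φ p q ≈ 0# → IdentityFactorisation m n
    eliminate {m} {n} φ p q pivot≉0 = record { left = left′ ; right = right′ ; factorises = factorises′ }
      where
        A = left φ
        B = right φ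
        π = punchIn p
        π′ = punchIn q

        pivot⁻¹ : Carrier
        pivot⁻¹ = proj₁ (proj₂ isField (B p q) pivot≉0)

        multiplier : Fin (suc n) → Carrier
        multiplier j = B p j * pivot⁻¹

        multiplier-scales : ∀ j → multiplier j * B p q ≈ B p j
        multiplier-scales j = begin
          B p j * pivot⁻¹ * B p q    ≈⟨ xy∙z≈x∙zy (B p j) pivot⁻¹ (B p q) ⟩
          B p j * (B p q * pivot⁻¹)  ≈⟨ *-congˡ (proj₂ (proj₂ isField (B p q) pivot≉0)) ⟩
          B p j * 1#                 ≈⟨ *-identityʳ (B p j) ⟩
          B p j                      ∎

        left′ right′ : Fin m → Fin n → Carrier
        left′ r i = A (π r) (π′ i)
        right′ r j = B (π r) (π′ j) + - multiplier (π′ j) * B (π r) q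

        without-p : ∀ i j → A p i * B p j + ∑[ r < m ] (A (π r) i * B (π r) j) ≈ var F i j
        without-p i j = trans (sym (sum-remove {m} {p} (λ r → A r i * B r j))) (factorises φ i j)

        factorises′ : ∀ i j → ∑[ r < m ] (left′ r i * right′ r j) ≈ var F i j
        factorises′ i j = begin
          ∑[ r < m ] (A (π r) (π′ i) * (B (π r) (π′ j) + - t * B (π r) q))
            ≈⟨ sum-cong-≋ {m} (λ r → trans (distribˡ _ _ _) (+-congˡ (x∙yz≈y∙xz _ (- t) _))) ⟩
          ∑[ r < m ] (A (π r) (π′ i) * B (π r) (π′ j) + - t * (A (π r) (π′ i) * B (π r) q))
            ≈⟨ trans (∑-distrib-+ {m} _ _) (+-congˡ (sym (*-distribˡ-sum {m} (- t) _))) ⟩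
          ∑[ r < m ] (A (π r) (π′ i) * B (π r) (π′ j)) + - t * ∑[ r < m ] (A (π r) (π′ i) * B (π r) q)
            ≈⟨ cancel-pivot-column (multiplier-scales (π′ j)) (without-p (π′ i) (π′ j))
                 (trans (without-p (π′ i) q) (≡⇒≈ (var-offdiag (punchInᵢ≢i q i)))) ⟩
          var F (π′ i) (π′ j)
            ≈⟨ ≡⇒≈ (var-injective (λ {x} {y} → punchIn-injective q x y) i j) ⟩
          var F i j ∎
          where t = multiplier (π′ j)

    no-factorisation : ∀ m → ¬ IdentityFactorisation m (suc m)
    no-factorisation zero    = no-factorisation-through-zero
    no-factorisation (suc m) φ = pivot-exists φ fz λ (p , pivot≉0) →
      no-factorisation m (eliminate φ p fz pivot≉0)

  S2≈0⇒identityFactorisation : ∀ {k′} (ls : Fin k′ → LinForm F (suc (suc k′))) →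
    IsZeroQuad F (S2 F (appendForms F (var F) ls)) → IdentityFactorisation (suc k′) (suc (suc k′))
  S2≈0⇒identityFactorisation {k′} ls S2≈0 = record
    { left = λ { fz → L ; (fs b) i → - ls b i }
    ; right = λ { fz → L ; (fs b) → ls b }
    ; factorises = factorises
    }
    where
      n = suc (suc k′)
      Y = appendForms F (var F) ls
      L : LinForm F n
      L i = ∑[ a < n ℕ.+ k′ ] Y a i

      factorises : ∀ i j → L i * L j + ∑[ b < k′ ] (- ls b i * ls b j) ≈ var F i j
      factorises i j = begin
        L i * L j + ∑[ b < k′ ] (- ls b i * ls b j)
          ≈⟨ +-cong (square-of-sum≈sum-of-squares Y S2≈0 i j)
                    (trans (sum-cong-≋ {k′} λ b → sym (-‿distribˡ-* _ _)) (sum-neg {k′} (λ b → ls b i * ls b j))) ⟩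
        ∑[ a < n ℕ.+ k′ ] (Y a i * Y a j) + - Q
          ≈⟨ +-congʳ (sum-appendForms n (var F) ls (λ y → y i * y j)) ⟩
        ∑[ a < n ] (var F a i * var F a j) + Q + - Q
          ≈⟨ +-congʳ (+-congʳ (∑-var i (λ a → var F a j))) ⟩
        var F i j + Q + - Q
          ≈⟨ trans (+-assoc _ _ _) (trans (+-congˡ (-‿inverseʳ Q)) (+-identityʳ _)) ⟩
        var F i j ∎
        where
          Q = ∑[ b < k′ ] (ls b i * ls b j)

mainTheorem19 : ∀ {c ℓ} (F : CommutativeRing c ℓ) → IsField F →
    ¬ (CommutativeRing._≈_ F (natF F 2) (CommutativeRing.0# F)) →
    (k' : ℕ) →
    ¬ (CommutativeRing._≈_ F (natF F (suc (suc k'))) (CommutativeRing.0# F)) →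
    (ls : Fin k' → LinForm F (suc (suc k'))) →
    ¬ IsZeroQuad F (S2 F (appendForms F (var F) ls))
mainTheorem19 F isField _ k′ _ ls S2≈0 =
  no-factorisation F isField (suc k′) (S2≈0⇒identityFactorisation F ls S2≈0)
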